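{- For every integer $N \geq 2$ there exists a multiset $\mathcal{H}$ of subsets $H \subseteq [N]$, each with $\sqrt{N} \leq |H| \leq N$, such that every subset $F \subseteq [N]$ hits at most an $O\left(\frac{1}{\log N}\right)$ fraction of the members of $\mathcal{H}$ (counted with multiplicity).
   Context: For sets $F, H \subseteq [N]$, $F$ hits $H$ if $|F \cap H| = 1$. The constant in $O(\cdot)$ is absolute. -}

module Defs where

open import Data.Nat using (ℕ; _≟_)
open import Data.List using (List; filter)
open import Data.List using (length)
open import Data.Fin.Subset using (Subset; _∩_; ∣_∣)
open import Relation.Nullary.Decidable using (Dec)

Hits : ∀ {N} → Subset N → Subset N → Set
Hits F H = ∣ F ∩ H ∣ Relation.Binary.PropositionalEquality.≡ 1
  where import Relation.Binary.PropositionalEquality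

hits? : ∀ {N} (F H : Subset N) → Dec (Hits F H)
hits? F H = ∣ F ∩ H ∣ ≟ 1

-- number of members of the multiset ℋ (a list, counted with multiplicity) hit by F
hitCount : ∀ {N} → Subset N → List (Subset N) → ℕ
hitCount F ℋ = length (filter (hits? F) ℋ)

{-# OPTIONS --safe #-}
-- Write N = 2^K + r with r < 2^K and work on the first 2^K points. Take the dyadic blocks of [2^K] on
-- the top ℓ ≈ K/2 levels, each level weighted to total 2^K: blocks then have size at least √N and the
-- family has total weight ℓ·2^K. If F hits a block, F misses one of its two halves entirely, so by
-- induction over the levels F hits total weight at most 2^(K+1), a fraction 2/ℓ = O(1/log N).
module Submission where

open import Defs
open import Data.Nat using (ℕ; zero; suc; _≤_; _<_; _*_; _+_; _∸_; _^_; z≤n; s≤s; ⌊_/2⌋; ⌈_/2⌉)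
open import Data.Nat.Properties
open import Data.Nat.Logarithm using (⌊log₂_⌋; ⌊log₂⌋-mono-≤; ⌊log₂[2^n]⌋≡n)
open import Data.Nat.Solver using (module +-*-Solver)
open import Data.List using (List; []; _∷_; length; map; replicate; filter) renaming (_++_ to _++ˡ_)
open import Data.List.Properties using (filter-++; length-filter; length-++; length-map; length-replicate; filter-none; filter-accept; filter-reject)
open import Data.List.Relation.Unary.All using (All; []; _∷_; universal) renaming (map to All-map)
open import Data.List.Relation.Unary.All.Properties using (++⁺; map⁺; replicate⁺)
open import Data.Fin.Subset using (Subset; ∣_∣; _∩_; ⊤; ⊥; inside; outside)
open import Data.Fin.Subset.Properties using (∩-identityʳ; ∩-zeroʳ; ∣p∩q∣≤∣p∣; ∣⊥∣≡0; ∣⊤∣≡n; ∣p∣≤n)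
open import Data.Vec using (_++_; splitAt) renaming ([] to []ᵛ; _∷_ to _∷ᵛ_)
open import Data.Vec.Properties using (zipWith-++)
open import Data.Product using (∃-syntax; _×_; _,_)
open import Data.Sum using (_⊎_; inj₁; inj₂)
open import Relation.Nullary using (yes; no; ¬_; contradiction)
open import Relation.Binary.PropositionalEquality
open import Function using (_∘_)

∣p++q∣≡∣p∣+∣q∣ : ∀ {m n} (p : Subset m) (q : Subset n) → ∣ p ++ q ∣ ≡ ∣ p ∣ + ∣ q ∣
∣p++q∣≡∣p∣+∣q∣ []ᵛ           q = refl
∣p++q∣≡∣p∣+∣q∣ (inside ∷ᵛ p)  q = cong suc (∣p++q∣≡∣p∣+∣q∣ p q)
∣p++q∣≡∣p∣+∣q∣ (outside ∷ᵛ p) q = ∣p++q∣≡∣p∣+∣q∣ p q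

∣p++q∣≡1⇒∣p∣≡0⊎∣q∣≡0 : ∀ {m n} (p : Subset m) (q : Subset n) → ∣ p ++ q ∣ ≡ 1 → ∣ p ∣ ≡ 0 ⊎ ∣ q ∣ ≡ 0
∣p++q∣≡1⇒∣p∣≡0⊎∣q∣≡0 p q ∣p++q∣≡1 with ∣ p ∣ | ∣p++q∣≡∣p∣+∣q∣ p q
... | zero  | _  = inj₁ refl
... | suc a | eq = inj₂ (m+n≡0⇒n≡0 a (suc-injective (trans (sym eq) ∣p++q∣≡1)))

∩-++ : ∀ {m n} (p p′ : Subset m) (q q′ : Subset n) → (p ++ q) ∩ (p′ ++ q′) ≡ (p ∩ p′) ++ (q ∩ q′)
∩-++ p p′ q q′ = zipWith-++ _ p q p′ q′

padʳ : ∀ {m n} → Subset m → Subset (m + n)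
padʳ p = p ++ ⊥

padˡ : ∀ {m n} → Subset n → Subset (m + n)
padˡ q = ⊥ ++ q

∣padʳ∣ : ∀ {m n} (p : Subset m) → ∣ padʳ {n = n} p ∣ ≡ ∣ p ∣
∣padʳ∣ {n = n} p = trans (∣p++q∣≡∣p∣+∣q∣ p (⊥ {n})) (trans (cong (∣ p ∣ +_) (∣⊥∣≡0 n)) (+-identityʳ _))

∣padˡ∣ : ∀ {m n} (q : Subset n) → ∣ padˡ {m} q ∣ ≡ ∣ q ∣
∣padˡ∣ {m} q = trans (∣p++q∣≡∣p∣+∣q∣ (⊥ {m}) q) (cong (_+ ∣ q ∣) (∣⊥∣≡0 m))

∣p++q∩padʳ∣ : ∀ {m n} (p H : Subset m) (q : Subset n) → ∣ (p ++ q) ∩ padʳ H ∣ ≡ ∣ p ∩ H ∣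
∣p++q∩padʳ∣ p H q = begin
  ∣ (p ++ q) ∩ (H ++ ⊥) ∣   ≡⟨ cong ∣_∣ (trans (∩-++ p H q ⊥) (cong ((p ∩ H) ++_) (∩-zeroʳ q))) ⟩
  ∣ padʳ (p ∩ H) ∣          ≡⟨ ∣padʳ∣ (p ∩ H) ⟩
  ∣ p ∩ H ∣                 ∎
  where open ≡-Reasoning

∣p++q∩padˡ∣ : ∀ {m n} (p : Subset m) (q H : Subset n) → ∣ (p ++ q) ∩ padˡ H ∣ ≡ ∣ q ∩ H ∣
∣p++q∩padˡ∣ {m} p q H = begin
  ∣ (p ++ q) ∩ padˡ {m} H ∣ ≡⟨ cong ∣_∣ (trans (∩-++ p (⊥ {m}) q H) (cong (_++ (q ∩ H)) (∩-zeroʳ p))) ⟩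
  ∣ padˡ {m} (q ∩ H) ∣      ≡⟨ ∣padˡ∣ {m} (q ∩ H) ⟩
  ∣ q ∩ H ∣                 ∎
  where open ≡-Reasoning

hitCount-++ : ∀ {n} (F : Subset n) ℋ 𝒢 → hitCount F (ℋ ++ˡ 𝒢) ≡ hitCount F ℋ + hitCount F 𝒢
hitCount-++ F ℋ 𝒢 = trans (cong length (filter-++ (hits? F) ℋ 𝒢)) (length-++ (filter (hits? F) ℋ))

hitCount≤length : ∀ {n} (F : Subset n) ℋ → hitCount F ℋ ≤ length ℋ
hitCount≤length F = length-filter (hits? F)

hitCount-replicate≤ : ∀ {n} (F : Subset n) k H → hitCount F (replicate k H) ≤ k
hitCount-replicate≤ F k H = ≤-trans (hitCount≤length F (replicate k H)) (≤-reflexive (length-replicate k))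

hitCount-map : ∀ {m n} (F : Subset n) (G : Subset m) (f : Subset m → Subset n) →
               (∀ H → ∣ F ∩ f H ∣ ≡ ∣ G ∩ H ∣) → ∀ ℋ → hitCount F (map f ℋ) ≡ hitCount G ℋ
hitCount-map F G f same []      = refl
hitCount-map F G f same (H ∷ ℋ) with hits? F (f H) | hits? G H
... | yes FfH | yes GH
  rewrite filter-accept (hits? F) {f H} {map f ℋ} FfH | filter-accept (hits? G) {H} {ℋ} GH
  = cong suc (hitCount-map F G f same ℋ)
... | no ¬FfH | no ¬GH
  rewrite filter-reject (hits? F) {f H} {map f ℋ} ¬FfH | filter-reject (hits? G) {H} {ℋ} ¬GH
  = hitCount-map F G f same ℋ
... | yes FfH | no ¬GH  = contradiction (trans (sym (same H)) FfH) ¬GH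
... | no ¬FfH | yes GH  = contradiction (trans (same H) GH) ¬FfH

hitCount-∅ : ∀ {n} (F : Subset n) → ∣ F ∣ ≡ 0 → ∀ ℋ → hitCount F ℋ ≡ 0
hitCount-∅ F ∣F∣≡0 ℋ = cong length (filter-none (hits? F) (universal misses ℋ))
  where
  misses : ∀ H → ¬ Hits F H
  misses H hit = 1+n≰n (subst₂ _≤_ hit ∣F∣≡0 (∣p∩q∣≤∣p∣ F H))

hitCount-⊤ : ∀ {n} (F : Subset n) → ∣ F ∣ ≢ 1 → ∀ k → hitCount F (replicate k ⊤) ≡ 0
hitCount-⊤ F ∣F∣≢1 k = cong length (filter-none (hits? F) (replicate⁺ k misses))
  where
  misses : ¬ Hits F ⊤
  misses = ∣F∣≢1 ∘ subst (λ G → ∣ G ∣ ≡ 1) (∩-identityʳ F)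

-- Unlike 2 ^ (suc k) = 2 ^ k + (2 ^ k + 0), this makes Subset (pow₂ (suc k)) split into two halves definitionally.
pow₂ : ℕ → ℕ
pow₂ zero    = 1
pow₂ (suc k) = pow₂ k + pow₂ k

pow₂≡2^ : ∀ k → pow₂ k ≡ 2 ^ k
pow₂≡2^ zero    = refl
pow₂≡2^ (suc k) = cong₂ _+_ (pow₂≡2^ k) (trans (pow₂≡2^ k) (sym (+-identityʳ _)))

pow₂>0 : ∀ k → 0 < pow₂ k
pow₂>0 k = subst (0 <_) (sym (pow₂≡2^ k)) (m^n>0 2 k)

pow₂-mono-≤ : ∀ {j k} → j ≤ k → pow₂ j ≤ pow₂ k
pow₂-mono-≤ {j} {k} j≤k = subst₂ _≤_ (sym (pow₂≡2^ j)) (sym (pow₂≡2^ k)) (^-monoʳ-≤ 2 j≤k)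

pow₂-+ : ∀ j k → pow₂ (j + k) ≡ pow₂ j * pow₂ k
pow₂-+ zero    k = sym (+-identityʳ _)
pow₂-+ (suc j) k = trans (cong₂ _+_ (pow₂-+ j k) (pow₂-+ j k)) (sym (*-distribʳ-+ (pow₂ k) (pow₂ j) (pow₂ j)))

⌊log₂⌋≤ : ∀ {N} k → N ≤ pow₂ k → ⌊log₂ N ⌋ ≤ k
⌊log₂⌋≤ {N} k N≤ = subst (⌊log₂ N ⌋ ≤_) (⌊log₂[2^n]⌋≡n k) (⌊log₂⌋-mono-≤ (subst (N ≤_) (pow₂≡2^ k) N≤))

binary-decomposition : ∀ N → 0 < N → ∃[ k ] ∃[ r ] (N ≡ pow₂ k + r × r < pow₂ k)
binary-decomposition (suc zero)    _ = 0 , 0 , refl , s≤s z≤n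
binary-decomposition (suc (suc N)) _ with binary-decomposition (suc N) (s≤s z≤n)
... | k , r , N≡ , r< with suc r <? pow₂ k
...   | yes r+1< = k , suc r , trans (cong suc N≡) (sym (+-suc (pow₂ k) r)) , r+1<
...   | no  r+1≮ = suc k , 0 , N+1≡ , pow₂>0 (suc k)
  where
  N+1≡ : suc (suc N) ≡ pow₂ (suc k) + 0
  N+1≡ = begin
    suc (suc N)          ≡⟨ cong suc N≡ ⟩
    suc (pow₂ k + r)     ≡⟨ sym (+-suc (pow₂ k) r) ⟩
    pow₂ k + suc r       ≡⟨ cong (pow₂ k +_) (≤-antisym r< (≮⇒≥ r+1≮)) ⟩
    pow₂ (suc k)         ≡⟨ sym (+-identityʳ _) ⟩
    pow₂ (suc k) + 0     ∎
    where open ≡-Reasoning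

-- The top ℓ levels of the dyadic decomposition of [2^k]: each block of size 2^j is taken 2^(k-j)
-- times, so that every level has total weight 2^k (levels below the singletons do not exist and are dropped).
dyadic : (k ℓ : ℕ) → List (Subset (pow₂ k))
halves : (k ℓ : ℕ) → List (Subset (pow₂ k))

dyadic k zero    = []
dyadic k (suc ℓ) = replicate (pow₂ k) ⊤ ++ˡ halves k ℓ

halves zero    ℓ = []
halves (suc k) ℓ = map padʳ (dyadic k ℓ) ++ˡ map (padˡ {pow₂ k}) (dyadic k ℓ)

length-dyadic : ∀ k ℓ → ℓ ≤ suc k → length (dyadic k ℓ) ≡ ℓ * pow₂ k
length-halves : ∀ k ℓ → ℓ ≤ k → length (halves k ℓ) ≡ ℓ * pow₂ k

length-dyadic k zero    _         = refl
length-dyadic k (suc ℓ) (s≤s ℓ≤k) =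
  trans (length-++ (replicate (pow₂ k) ⊤)) (cong₂ _+_ (length-replicate (pow₂ k)) (length-halves k ℓ ℓ≤k))

length-halves zero    zero z≤n = refl
length-halves (suc k) ℓ ℓ≤k+1  = begin
  length (map padʳ D ++ˡ map (padˡ {pow₂ k}) D)  ≡⟨ length-++ (map padʳ D) ⟩
  length (map padʳ D) + length (map padˡ D)      ≡⟨ cong₂ _+_ (length-map padʳ D) (length-map (padˡ {pow₂ k}) D) ⟩
  length D + length D                            ≡⟨ cong₂ _+_ (length-dyadic k ℓ ℓ≤k+1) (length-dyadic k ℓ ℓ≤k+1) ⟩
  ℓ * pow₂ k + ℓ * pow₂ k                        ≡⟨ *-distribˡ-+ ℓ (pow₂ k) (pow₂ k) ⟨
  ℓ * pow₂ (suc k)                               ∎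
  where
  open ≡-Reasoning
  D = dyadic k ℓ

dyadic-large : ∀ k ℓ → All (λ H → pow₂ (suc k ∸ ℓ) ≤ ∣ H ∣) (dyadic k ℓ)
halves-large : ∀ k ℓ → All (λ H → pow₂ (k ∸ ℓ) ≤ ∣ H ∣) (halves k ℓ)

dyadic-large k zero    = []
dyadic-large k (suc ℓ) = ++⁺ (replicate⁺ (pow₂ k) ⊤-large) (halves-large k ℓ)
  where
  ⊤-large : pow₂ (k ∸ ℓ) ≤ ∣ ⊤ {pow₂ k} ∣
  ⊤-large = subst (pow₂ (k ∸ ℓ) ≤_) (sym (∣⊤∣≡n (pow₂ k))) (pow₂-mono-≤ (m∸n≤m k ℓ))

halves-large zero    ℓ = []
halves-large (suc k) ℓ =
  ++⁺ (map⁺ (All-map (λ {H} large → subst (_ ≤_) (sym (∣padʳ∣ H)) large) (dyadic-large k ℓ)))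
      (map⁺ (All-map (λ {H} large → subst (_ ≤_) (sym (∣padˡ∣ {pow₂ k} H)) large) (dyadic-large k ℓ)))

hitCount-halves : ∀ k ℓ (p q : Subset (pow₂ k)) →
                  hitCount (p ++ q) (halves (suc k) ℓ) ≡ hitCount p (dyadic k ℓ) + hitCount q (dyadic k ℓ)
hitCount-halves k ℓ p q = begin
  hitCount (p ++ q) (map padʳ D ++ˡ map padˡ D)             ≡⟨ hitCount-++ (p ++ q) (map padʳ D) _ ⟩
  hitCount (p ++ q) (map padʳ D) + hitCount (p ++ q) (map padˡ D)
    ≡⟨ cong₂ _+_ (hitCount-map (p ++ q) p padʳ (λ H → ∣p++q∩padʳ∣ p H q) D)
                 (hitCount-map (p ++ q) q (padˡ {pow₂ k}) (∣p++q∩padˡ∣ p q) D) ⟩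
  hitCount p D + hitCount q D                                ∎
  where
  open ≡-Reasoning
  D = dyadic k ℓ

hitCount-dyadic : ∀ k ℓ (F : Subset (pow₂ k)) → hitCount F (dyadic k ℓ) ≤ pow₂ (suc k)
hitCount-dyadic k       zero    F = z≤n
hitCount-dyadic zero    (suc ℓ) F = ≤-trans (hitCount≤length F (⊤ ∷ [])) (s≤s z≤n)
hitCount-dyadic (suc k) (suc ℓ) F with splitAt (pow₂ k) F
... | p , q , refl = begin
  hitCount (p ++ q) (⊤ⁿ ++ˡ halves (suc k) ℓ)                  ≡⟨ hitCount-++ (p ++ q) ⊤ⁿ _ ⟩
  hitCount (p ++ q) ⊤ⁿ + hitCount (p ++ q) (halves (suc k) ℓ)  ≡⟨ cong (_ +_) (hitCount-halves k ℓ p q) ⟩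
  hitCount (p ++ q) ⊤ⁿ + (hitCount p D + hitCount q D)         ≤⟨ split-bound ⟩
  pow₂ (suc k) + pow₂ (suc k)                                  ∎
  where
  open ≤-Reasoning
  ⊤ⁿ = replicate (pow₂ (suc k)) ⊤
  D  = dyadic k ℓ
  ⊤ⁿ-bound : hitCount (p ++ q) ⊤ⁿ ≤ pow₂ (suc k)
  ⊤ⁿ-bound = hitCount-replicate≤ (p ++ q) (pow₂ (suc k)) ⊤
  split-bound : hitCount (p ++ q) ⊤ⁿ + (hitCount p D + hitCount q D) ≤ pow₂ (suc k) + pow₂ (suc k)
  split-bound with ∣ p ++ q ∣ ≟ 1
  ... | no ≢1 rewrite hitCount-⊤ (p ++ q) ≢1 (pow₂ (suc k)) =
    +-mono-≤ (hitCount-dyadic k ℓ p) (hitCount-dyadic k ℓ q)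
  ... | yes ≡1 with ∣p++q∣≡1⇒∣p∣≡0⊎∣q∣≡0 p q ≡1
  ...   | inj₁ ∣p∣≡0 rewrite hitCount-∅ p ∣p∣≡0 D = +-mono-≤ ⊤ⁿ-bound (hitCount-dyadic k ℓ q)
  ...   | inj₂ ∣q∣≡0 rewrite hitCount-∅ q ∣q∣≡0 D | +-identityʳ (hitCount p D) =
    +-mono-≤ ⊤ⁿ-bound (hitCount-dyadic k ℓ p)

n∸⌊n/2⌋≡⌈n/2⌉ : ∀ n → n ∸ ⌊ n /2⌋ ≡ ⌈ n /2⌉
n∸⌊n/2⌋≡⌈n/2⌉ n = trans (cong (_∸ ⌊ n /2⌋) (sym (⌊n/2⌋+⌈n/2⌉≡n n))) (m+n∸m≡n ⌊ n /2⌋ ⌈ n /2⌉)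

n≤⌈n/2⌉+⌈n/2⌉ : ∀ n → n ≤ ⌈ n /2⌉ + ⌈ n /2⌉
n≤⌈n/2⌉+⌈n/2⌉ n = subst (_≤ ⌈ n /2⌉ + ⌈ n /2⌉) (⌊n/2⌋+⌈n/2⌉≡n n) (+-monoˡ-≤ ⌈ n /2⌉ (⌊n/2⌋≤⌈n/2⌉ n))

n≤3*⌊n/2⌋ : ∀ n → 2 ≤ n → n ≤ 3 * ⌊ n /2⌋
n≤3*⌊n/2⌋ n 2≤n = begin
  n                        ≡⟨ ⌊n/2⌋+⌈n/2⌉≡n n ⟨
  h + ⌈ n /2⌉              ≤⟨ +-monoʳ-≤ h (⌊n/2⌋-mono (n≤1+n (suc n))) ⟩
  h + suc h                ≤⟨ +-monoʳ-≤ h (+-monoˡ-≤ h (⌊n/2⌋-mono 2≤n)) ⟩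
  h + (h + h)              ≡⟨ cong (λ x → h + (h + x)) (+-identityʳ h) ⟨
  3 * h                    ∎
  where
  open ≤-Reasoning
  h = ⌊ n /2⌋

SparseFamily : ℕ → ℕ → Set
SparseFamily C N = ∃[ ℋ ] (0 < length {A = Subset N} ℋ
                         × All (λ H → N ≤ ∣ H ∣ * ∣ H ∣ × ∣ H ∣ ≤ N) ℋ
                         × ((F : Subset N) → hitCount F ℋ * ⌊log₂ N ⌋ ≤ C * length ℋ))

dyadic-sparse : ∀ k r → r < pow₂ (suc k) → SparseFamily 6 (pow₂ (suc k) + r)
dyadic-sparse k r r< = ℋ , nonempty , sizes , sparse
  where
  K = suc k
  n = suc K
  ℓ = ⌊ n /2⌋
  N = pow₂ K + r
  D = dyadic K ℓ
  ℋ = map padʳ D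

  length-ℋ : length ℋ ≡ ℓ * pow₂ K
  length-ℋ = trans (length-map padʳ D) (length-dyadic K ℓ (⌊n/2⌋≤n n))

  N≤pow₂n : N ≤ pow₂ n
  N≤pow₂n = <⇒≤ (+-monoʳ-< (pow₂ K) r<)

  nonempty : 0 < length ℋ
  nonempty = subst (0 <_) (sym length-ℋ) (≤-trans (pow₂>0 K) (m≤m+n (pow₂ K) _))

  N≤square : ∀ {m} → pow₂ (n ∸ ℓ) ≤ m → N ≤ m * m
  N≤square {m} large = begin
    N                                 ≤⟨ N≤pow₂n ⟩
    pow₂ n                            ≤⟨ pow₂-mono-≤ (n≤⌈n/2⌉+⌈n/2⌉ n) ⟩
    pow₂ (⌈ n /2⌉ + ⌈ n /2⌉)          ≡⟨ pow₂-+ ⌈ n /2⌉ ⌈ n /2⌉ ⟩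
    pow₂ ⌈ n /2⌉ * pow₂ ⌈ n /2⌉       ≡⟨ cong (λ c → pow₂ c * pow₂ c) (n∸⌊n/2⌋≡⌈n/2⌉ n) ⟨
    pow₂ (n ∸ ℓ) * pow₂ (n ∸ ℓ)       ≤⟨ *-mono-≤ large large ⟩
    m * m                             ∎
    where open ≤-Reasoning

  sizes : All (λ H → N ≤ ∣ H ∣ * ∣ H ∣ × ∣ H ∣ ≤ N) ℋ
  sizes = map⁺ (All-map (λ {H} large → N≤square (subst (_ ≤_) (sym (∣padʳ∣ H)) large) , ∣p∣≤n (padʳ H))
                        (dyadic-large K ℓ))

  sparse : (F : Subset N) → hitCount F ℋ * ⌊log₂ N ⌋ ≤ 6 * length ℋ
  sparse F with splitAt (pow₂ K) F
  ... | p , q , refl = begin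
    hitCount (p ++ q) ℋ * ⌊log₂ N ⌋   ≡⟨ cong (_* ⌊log₂ N ⌋) (hitCount-map (p ++ q) p padʳ (λ H → ∣p++q∩padʳ∣ p H q) D) ⟩
    hitCount p D * ⌊log₂ N ⌋          ≤⟨ *-mono-≤ (hitCount-dyadic K ℓ p) (⌊log₂⌋≤ n N≤pow₂n) ⟩
    pow₂ n * n                        ≤⟨ *-monoʳ-≤ (pow₂ n) (n≤3*⌊n/2⌋ n (s≤s (s≤s z≤n))) ⟩
    (pow₂ K + pow₂ K) * (3 * ℓ)       ≡⟨ double-triple (pow₂ K) ℓ ⟩
    6 * (ℓ * pow₂ K)                  ≡⟨ cong (6 *_) length-ℋ ⟨
    6 * length ℋ                      ∎
    where
    open ≤-Reasoning
    double-triple : ∀ x y → (x + x) * (3 * y) ≡ 6 * (y * x)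
    double-triple = solve 2 (λ x y → (x :+ x) :* (con 3 :* y) := con 6 :* (y :* x)) refl
      where open +-*-Solver

lemmaA3 : ∃[ C ] ((N : ℕ) → 2 ≤ N →
            ∃[ ℋ ] (0 < length {A = Subset N} ℋ
              × All (λ H → N ≤ ∣ H ∣ * ∣ H ∣ × ∣ H ∣ ≤ N) ℋ
              × ((F : Subset N) → hitCount F ℋ * ⌊log₂ N ⌋ ≤ C * length ℋ)))
lemmaA3 = 6 , family
  where
  family : ∀ N → 2 ≤ N → SparseFamily 6 N
  family N 2≤N with binary-decomposition N (≤-trans (s≤s z≤n) 2≤N)
  ... | zero  , zero  , refl , _  = contradiction 2≤N 1+n≰n
  ... | zero  , suc _ , _    , s≤s ()
  ... | suc k , r     , refl , r< = dyadic-sparse k r r<
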